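{- Let $G$ be a unicyclic graph on $n$ vertices with $G\neq K_{1,n-1}+e$, and suppose that either $G$ contains a cycle $C_\ell$ with $\ell\geq 5$ as an induced subgraph, or $G$ contains $C_4$ as an induced subgraph and exactly two vertices of this $4$-cycle have degree $2$ in $G$ and these two vertices are non-adjacent, or $G$ contains $C_4$ as an induced subgraph and exactly three vertices of this $4$-cycle have degree $2$ in $G$. Then $\operatorname{Z}(\overline{G})=n-3$.
   Context: All graphs are finite, simple and undirected. A unicyclic graph is a connected graph containing exactly one cycle. $K_{1,n-1}+e$ denotes the star $K_{1,n-1}$ with one edge added between two of its leaves. $\overline{G}$ denotes the complement of $G$ (same vertex set; distinct vertices adjacent iff not adjacent in $G$). Zero forcing: given an initial set $B\subseteq V(G)$ of blue vertices (all others white), a blue vertex with exactly one white neighbor may turn that neighbor blue; $B$ is a zero forcing set if repeated application makes all vertices blue. $\operatorname{Z}(G)$ is the minimum size of a zero forcing set of $G$. -}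

module Defs where

open import Data.Nat using (ℕ; zero; suc; _≤_; NonZero)
open import Data.Nat.DivMod using (_mod_)
open import Data.Bool using (Bool; true; false; not; _∧_; _∨_)
open import Data.Fin using (Fin; toℕ)
open import Data.Fin.Subset using (Subset; ∣_∣; _∈_; _∉_; ⁅_⁆; _∪_; Nonempty)
open import Data.Vec using (tabulate; lookup)
open import Data.Product using (Σ; ∃; ∃-syntax; _×_; _,_)
open import Data.Sum using (_⊎_)
open import Function using (_⇔_)
open import Function.Definitions using (Injective)
open import Relation.Nullary using (¬_)
open import Relation.Binary.PropositionalEquality using (_≡_; _≢_)

record Graph (n : ℕ) : Set where
  field
    adj   : Fin n → Fin n → Bool
    adj-sym : ∀ u v → adj u v ≡ adj v u
    adj-irrefl : ∀ v → adj v v ≡ false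
open Graph public

complement : ∀ {n} → Graph n → Graph n
complement {n} G = record
  { adj = λ u v → not (adj G u v) ∧ not (u ≡ᵇ v)
  ; adj-sym = λ u v → symC u v
  ; adj-irrefl = λ v → irrC v }
  where
  open import Data.Fin.Properties using (_≟_)
  open import Relation.Nullary.Decidable using (⌊_⌋)
  open import Relation.Binary.PropositionalEquality using (refl; cong₂; sym)
  open import Data.Bool.Properties using (∧-zeroʳ)
  open import Relation.Nullary using (yes; no)
  _≡ᵇ_ : Fin n → Fin n → Bool
  u ≡ᵇ v = ⌊ u ≟ v ⌋
  eqsym : ∀ u v → (u ≡ᵇ v) ≡ (v ≡ᵇ u)
  eqsym u v with u ≟ v | v ≟ u
  ... | yes _ | yes _ = refl
  ... | no _  | no _  = refl
  ... | yes p | no q  = Data.Empty.⊥-elim (q (sym p)) where import Data.Empty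
  ... | no p  | yes q = Data.Empty.⊥-elim (p (sym q)) where import Data.Empty
  symC : ∀ u v → (not (adj G u v) ∧ not (u ≡ᵇ v)) ≡ (not (adj G v u) ∧ not (v ≡ᵇ u))
  symC u v = cong₂ (λ a b → not a ∧ not b) (Graph.adj-sym G u v) (eqsym u v)
  irrC : ∀ v → (not (adj G v v) ∧ not (v ≡ᵇ v)) ≡ false
  irrC v with v ≟ v
  ... | yes _ = ∧-zeroʳ (not (adj G v v))
  ... | no ¬p = Data.Empty.⊥-elim (¬p refl) where import Data.Empty

_~[_]_ : ∀ {n} → Fin n → Graph n → Fin n → Set
u ~[ G ] v = adj G u v ≡ true

nbhd : ∀ {n} → Graph n → Fin n → Subset n
nbhd G v = tabulate (adj G v)

deg : ∀ {n} → Graph n → Fin n → ℕ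
deg G v = ∣ nbhd G v ∣

data Reach {n : ℕ} (G : Graph n) : Fin n → Fin n → Set where
  here : ∀ {v} → Reach G v v
  step : ∀ {u w v} → u ~[ G ] w → Reach G w v → Reach G u v

Connected : ∀ {n} → Graph n → Set
Connected G = ∀ u v → Reach G u v

next : ∀ {m} → Fin (suc m) → Fin (suc m)
next {m} i = suc (toℕ i) mod (suc m)

record Cycle {n : ℕ} (G : Graph n) : Set where
  field
    m      : ℕ
    len≥3  : 3 ≤ suc m
    vtx    : Fin (suc m) → Fin n
    inj    : Injective _≡_ _≡_ vtx
    edges  : ∀ i → vtx i ~[ G ] vtx (next i)

CycleEdge : ∀ {n} {G : Graph n} → Cycle G → Fin n → Fin n → Set
CycleEdge C x y =
  ∃[ i ] ((Cycle.vtx C i ≡ x × Cycle.vtx C (next i) ≡ y)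
        ⊎ (Cycle.vtx C i ≡ y × Cycle.vtx C (next i) ≡ x))

-- Two cycles are the same subgraph iff they have the same edge set
SameCycle : ∀ {n} {G : Graph n} → Cycle G → Cycle G → Set
SameCycle C D = ∀ x y → CycleEdge C x y ⇔ CycleEdge D x y

Unicyclic : ∀ {n} → Graph n → Set
Unicyclic G = Connected G × Σ (Cycle G) (λ C → ∀ D → SameCycle C D)

-- G contains C_ℓ (ℓ = suc m ≥ 3) as an induced subgraph, witnessed by an
-- injective labelling c of the cycle's vertices: c i ~ c j iff i,j consecutive.
InducedCycle : ∀ {n} → Graph n → (m : ℕ) → (Fin (suc m) → Fin n) → Set
InducedCycle G m c =
  Injective _≡_ _≡_ c ×
  (∀ i j → c i ~[ G ] c j ⇔ (j ≡ next i ⊎ i ≡ next j))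

-- G is (isomorphic to) K_{1,n-1}+e: there is a centre z and two distinct
-- leaves a, b such that x ~ y iff exactly one of x, y is z, or {x,y} = {a,b}.
IsStarPlusEdge : ∀ {n} → Graph n → Set
IsStarPlusEdge {n} G =
  ∃[ z ] ∃[ a ] ∃[ b ] (a ≢ b × a ≢ z × b ≢ z ×
    (∀ x y → x ~[ G ] y ⇔
       ((x ≡ z × y ≢ z) ⊎ (y ≡ z × x ≢ z) ⊎ (x ≡ a × y ≡ b) ⊎ (x ≡ b × y ≡ a))))

-- Zero forcing.  A blue vertex u with exactly one white neighbour w forces w.
-- `Forces G B` : starting from blue set B, some sequence of forces turns
-- every vertex blue.
data Forces {n : ℕ} (G : Graph n) : Subset n → Set where
  done  : ∀ {B} → (∀ v → v ∈ B) → Forces G B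
  force : ∀ {B} (u w : Fin n) →
          u ∈ B → w ∉ B → u ~[ G ] w →
          (∀ w' → u ~[ G ] w' → w' ∉ B → w' ≡ w) →
          Forces G (B ∪ ⁅ w ⁆) → Forces G B

IsZeroForcingSet : ∀ {n} → Graph n → Subset n → Set
IsZeroForcingSet G B = Forces G B

ZeroForcingNumber : ∀ {n} → Graph n → ℕ → Set
ZeroForcingNumber {n} G k =
  (∃[ B ] (IsZeroForcingSet G B × ∣ B ∣ ≡ k)) ×
  (∀ B → IsZeroForcingSet G B → k ≤ ∣ B ∣)

deg2Count : ∀ {n m} → Graph n → (Fin (suc m) → Fin n) → ℕ
deg2Count G c = ∣ tabulate (λ i → deg G (c i) Data.Nat.≡ᵇ 2) ∣

module Submission where

-- In the complement of G a blue vertex forces w exactly when it is adjacent in G to every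
-- other white vertex.  So if four vertices are white, the first force leaves three whites
-- with a common G-neighbour u; the next leaves two whites a, b with two common neighbours
-- u, u′, where u has degree ≥ 3; and the force of a (or b) gives b (or a) a third neighbour.
-- Then u and b are adjacent vertices of degree ≥ 3 on the 4-cycle u a u′ b.  In a
-- unicyclic graph whose cycle is induced of length ≥ 5 there is no 4-cycle at all, and
-- under the degree hypotheses on an induced 4-cycle no two adjacent cycle vertices have
-- degree ≥ 3; hence Z(Ḡ) ≥ n − 3.
-- Conversely, whites x, y, z with y ≁ z are forced in turn by some u ~ y, z with u ≁ x, some
-- u′ ~ z with u′ ≁ y, and finally by y.  On a long induced cycle c take (x, y, z, u, u′) =
-- (c₃, c₀, c₂, c₁, c₃); on an induced 4-cycle with deg c₁ ≥ 3 take (c₂, c₃, c₁, c₀, p) for a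
-- neighbour p of c₁ off the cycle, which is not adjacent to c₃ as G has only one cycle.

open import Defs
open import Data.Bool using (Bool; true; false)
open import Data.Bool.Properties using (T-≡)
open import Data.Empty using (⊥; ⊥-elim)
open import Data.Fin using (Fin; zero; suc; #_; _≟_)
open import Data.Fin.Properties using (injective⇒≤)
open import Data.Fin.Subset
  using (Subset; ∣_∣; _∈_; _∉_; ⁅_⁆; _─_; _-_; _∪_; ∁; ⊤; Nonempty; inside; outside)
open import Data.Fin.Subset.Properties
  using (p─⊥≡p; p─q⊆p; x∈p∧x≢y⇒x∈p-y; x∈p⇒∣p-x∣<∣p∣; nonempty?; Empty-unique; ∣⊥∣≡0; ∈⊤; ∣⊤∣≡n;
         x∈⁅x⁆; x∈⁅y⁆⇒x≡y; x∈p∪q⁺; x∈p∪q⁻; _∈?_; x∈∁p⇒x∉p; x∉p⇒x∈∁p; x∉∁p⇒x∈p; ∣∁p∣≡n∸∣p∣)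
open import Data.Nat using (ℕ; zero; suc; _≤_; _<_; _∸_; _+_; z≤n; s≤s; s≤s⁻¹; _≤?_; _≡ᵇ_)
import Data.Nat as ℕ
open import Data.Nat.Properties
  using (≤-trans; ≤-reflexive; <-irrefl; <⇒≢; ≰⇒>; +-monoʳ-≤; +-comm; m≤n+m∸n; m≤n+o⇒m∸n≤o;
         m≤n⇒m≤1+n; m<n⇒0<n∸m; ≡ᵇ⇒≡; ≡⇒≡ᵇ; module ≤-Reasoning)
open import Data.Product using (∃-syntax; _×_; _,_; proj₁; proj₂)
open import Data.Sum using (_⊎_; inj₁; inj₂)
import Data.Sum as Sum
open import Data.Vec using (_∷_; tabulate; here; there)
open import Data.Vec.Properties using (lookup∘tabulate; []=⇒lookup; lookup⇒[]=)
open import Function using (Equivalence; mk⇔; _∘_)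
open Equivalence using (to; from)
open import Relation.Nullary using (¬_; yes; no; contradiction)
open import Relation.Binary.PropositionalEquality

x∈p⇒suc∣p-x∣≡∣p∣ : ∀ {n} {x : Fin n} {p : Subset n} → x ∈ p → suc ∣ p - x ∣ ≡ ∣ p ∣
x∈p⇒suc∣p-x∣≡∣p∣ {p = inside ∷ p} here = cong (suc ∘ ∣_∣) (p─⊥≡p p)
x∈p⇒suc∣p-x∣≡∣p∣ {p = inside ∷ p} (there x∈p) = cong suc (x∈p⇒suc∣p-x∣≡∣p∣ x∈p)
x∈p⇒suc∣p-x∣≡∣p∣ {p = outside ∷ p} (there x∈p) = x∈p⇒suc∣p-x∣≡∣p∣ x∈p

x∈q⇒x∉p─q : ∀ {n} {x : Fin n} {p q : Subset n} → x ∈ q → x ∉ p ─ q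
x∈q⇒x∉p─q {p = _ ∷ p} {q = inside ∷ q} here ()
x∈q⇒x∉p─q {p = _ ∷ p} {q = _ ∷ q} (there x∈q) (there x∈p─q) = x∈q⇒x∉p─q x∈q x∈p─q

x∈p-y⇒x≢y : ∀ {n} {x y : Fin n} {p : Subset n} → x ∈ p - y → x ≢ y
x∈p-y⇒x≢y {x = x} x∈p-x refl = x∈q⇒x∉p─q (x∈⁅x⁆ x) x∈p-x

0<∣p∣⇒Nonempty : ∀ {n} {p : Subset n} → 0 < ∣ p ∣ → Nonempty p
0<∣p∣⇒Nonempty {n} {p} 0<∣p∣ with nonempty? p
... | yes ne = ne
... | no ¬ne with () ← subst (0 <_) (trans (cong ∣_∣ (Empty-unique ¬ne)) (∣⊥∣≡0 n)) 0<∣p∣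

remove-member : ∀ {n k} {p : Subset n} → k < ∣ p ∣ → ∃[ x ] (x ∈ p × k ≤ ∣ p - x ∣)
remove-member k<∣p∣ with 0<∣p∣⇒Nonempty (≤-trans (s≤s z≤n) k<∣p∣)
... | x , x∈p = x , x∈p , s≤s⁻¹ (subst (_ ≤_) (sym (x∈p⇒suc∣p-x∣≡∣p∣ x∈p)) k<∣p∣)

x∈p⇒0<∣p∣ : ∀ {n} {x : Fin n} {p : Subset n} → x ∈ p → 0 < ∣ p ∣
x∈p⇒0<∣p∣ x∈p = ≤-trans (s≤s z≤n) (x∈p⇒∣p-x∣<∣p∣ x∈p)

x∈p∧k≤∣p-x∣⇒k<∣p∣ : ∀ {n k} {x : Fin n} {p : Subset n} → x ∈ p → k ≤ ∣ p - x ∣ → k < ∣ p ∣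
x∈p∧k≤∣p-x∣⇒k<∣p∣ x∈p k≤ = subst (_ ≤_) (x∈p⇒suc∣p-x∣≡∣p∣ x∈p) (s≤s k≤)

two-members⇒2≤∣p∣ : ∀ {n} {x y : Fin n} {p : Subset n} → x ∈ p → y ∈ p → x ≢ y → 2 ≤ ∣ p ∣
two-members⇒2≤∣p∣ x∈p y∈p x≢y =
  x∈p∧k≤∣p-x∣⇒k<∣p∣ x∈p (x∈p⇒0<∣p∣ (x∈p∧x≢y⇒x∈p-y y∈p (≢-sym x≢y)))

three-members⇒3≤∣p∣ : ∀ {n} {x y z : Fin n} {p : Subset n} → x ∈ p → y ∈ p → z ∈ p →
                      x ≢ y → x ≢ z → y ≢ z → 3 ≤ ∣ p ∣
three-members⇒3≤∣p∣ x∈p y∈p z∈p x≢y x≢z y≢z =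
  x∈p∧k≤∣p-x∣⇒k<∣p∣ x∈p
    (two-members⇒2≤∣p∣ (x∈p∧x≢y⇒x∈p-y y∈p (≢-sym x≢y)) (x∈p∧x≢y⇒x∈p-y z∈p (≢-sym x≢z)) y≢z)

x∉p-y⇒x≡y⊎x∉p : ∀ {n} {x y : Fin n} {p : Subset n} → x ∉ p - y → x ≡ y ⊎ x ∉ p
x∉p-y⇒x≡y⊎x∉p {x = x} {y} x∉p-y with x ≟ y
... | yes x≡y = inj₁ x≡y
... | no x≢y = inj₂ λ x∈p → x∉p-y (x∈p∧x≢y⇒x∈p-y x∈p x≢y)

x∉p∧y≢x⇒x∉p∪⁅y⁆ : ∀ {n} {x y : Fin n} {p : Subset n} → x ∉ p → y ≢ x → x ∉ p ∪ ⁅ y ⁆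
x∉p∧y≢x⇒x∉p∪⁅y⁆ {y = y} {p} x∉p y≢x x∈ with x∈p∪q⁻ p ⁅ y ⁆ x∈
... | inj₁ x∈p = x∉p x∈p
... | inj₂ x∈⁅y⁆ = y≢x (sym (x∈⁅y⁆⇒x≡y y x∈⁅y⁆))

x∉p∪q⇒x∉p : ∀ {n} {x : Fin n} {p q : Subset n} → x ∉ p ∪ q → x ∉ p
x∉p∪q⇒x∉p x∉p∪q x∈p = x∉p∪q (x∈p∪q⁺ (inj₁ x∈p))

x∉p∪⁅y⁆⇒x≢y : ∀ {n} {x y : Fin n} {p : Subset n} → x ∉ p ∪ ⁅ y ⁆ → x ≢ y
x∉p∪⁅y⁆⇒x≢y {x = x} x∉p∪⁅x⁆ refl = x∉p∪⁅x⁆ (x∈p∪q⁺ (inj₂ (x∈⁅x⁆ x)))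

module _ {n} {x y z : Fin n} where

  ∉⊤-x-y-z : ∀ {v} → v ∉ ⊤ - x - y - z → v ≡ x ⊎ v ≡ y ⊎ v ≡ z
  ∉⊤-x-y-z v∉ with x∉p-y⇒x≡y⊎x∉p v∉
  ... | inj₁ v≡z = inj₂ (inj₂ v≡z)
  ... | inj₂ v∉′ with x∉p-y⇒x≡y⊎x∉p v∉′
  ... | inj₁ v≡y = inj₂ (inj₁ v≡y)
  ... | inj₂ v∉″ with x∉p-y⇒x≡y⊎x∉p v∉″
  ... | inj₁ v≡x = inj₁ v≡x
  ... | inj₂ v∉⊤ = contradiction ∈⊤ v∉⊤

  ∈⊤-x-y : ∀ {v} → v ≢ x → v ≢ y → v ∈ ⊤ - x - y
  ∈⊤-x-y v≢x v≢y = x∈p∧x≢y⇒x∈p-y (x∈p∧x≢y⇒x∈p-y ∈⊤ v≢x) v≢y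

  ∈⊤-x-y-z : ∀ {v} → v ≢ x → v ≢ y → v ≢ z → v ∈ ⊤ - x - y - z
  ∈⊤-x-y-z v≢x v≢y = x∈p∧x≢y⇒x∈p-y (∈⊤-x-y v≢x v≢y)

  ∣⊤-x-y-z∣≡n∸3 : x ≢ y → x ≢ z → y ≢ z → ∣ ⊤ - x - y - z ∣ ≡ n ∸ 3
  ∣⊤-x-y-z∣≡n∸3 x≢y x≢z y≢z = cong (_∸ 3) (begin
    3 + ∣ ⊤ - x - y - z ∣  ≡⟨ cong (2 +_) (x∈p⇒suc∣p-x∣≡∣p∣ (∈⊤-x-y (≢-sym x≢z) (≢-sym y≢z))) ⟩
    2 + ∣ ⊤ - x - y ∣      ≡⟨ cong suc (x∈p⇒suc∣p-x∣≡∣p∣ (x∈p∧x≢y⇒x∈p-y ∈⊤ (≢-sym x≢y))) ⟩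
    1 + ∣ ⊤ - x ∣          ≡⟨ x∈p⇒suc∣p-x∣≡∣p∣ (∈⊤ {x = x}) ⟩
    ∣ ⊤ {n} ∣              ≡⟨ ∣⊤∣≡n n ⟩
    n                      ∎)
    where open ≡-Reasoning

∈-tabulate⁺ : ∀ {n} (f : Fin n → Bool) {i} → f i ≡ true → i ∈ tabulate f
∈-tabulate⁺ f {i} fi = lookup⇒[]= i (tabulate f) (trans (lookup∘tabulate f i) fi)

∈-tabulate⁻ : ∀ {n} (f : Fin n → Bool) {i} → i ∈ tabulate f → f i ≡ true
∈-tabulate⁻ f {i} i∈ = trans (sym (lookup∘tabulate f i)) ([]=⇒lookup i∈)

m∸n≤o⇒m∸o≤n : ∀ m n o → m ∸ n ≤ o → m ∸ o ≤ n
m∸n≤o⇒m∸o≤n m n o m∸n≤o = m≤n+o⇒m∸n≤o m o (begin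
  m            ≤⟨ m≤n+m∸n m n ⟩
  n + (m ∸ n)  ≤⟨ +-monoʳ-≤ n m∸n≤o ⟩
  n + o        ≡⟨ +-comm n o ⟩
  o + n        ∎)
  where open ≤-Reasoning

module GraphProperties {n} (G : Graph n) where

  ~-sym : ∀ {u v} → u ~[ G ] v → v ~[ G ] u
  ~-sym {u} {v} u~v = trans (adj-sym G v u) u~v

  ~⇒≢ : ∀ {u v} → u ~[ G ] v → u ≢ v
  ~⇒≢ {u} u~u refl with () ← trans (sym u~u) (adj-irrefl G u)

  ≁⇒¬~ : ∀ {u v} → adj G u v ≡ false → ¬ u ~[ G ] v
  ≁⇒¬~ u≁v u~v with () ← trans (sym u~v) u≁v

  complement-adj⁺ : ∀ {u v} → adj G u v ≡ false → u ≢ v → u ~[ complement G ] v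
  complement-adj⁺ {u} {v} u≁v u≢v with u ≟ v
  ... | yes u≡v = contradiction u≡v u≢v
  ... | no _ rewrite u≁v = refl

  complement-adj⁻ : ∀ {u v} → u ~[ complement G ] v → adj G u v ≡ false
  complement-adj⁻ {u} {v} u~̄v with adj G u v
  ... | false = refl

  ~⇒¬complement-adj : ∀ {u v} → u ~[ G ] v → ¬ u ~[ complement G ] v
  ~⇒¬complement-adj u~v u~̄v = ≁⇒¬~ (complement-adj⁻ u~̄v) u~v

  ∈-nbhd : ∀ {u v} → u ~[ G ] v → v ∈ nbhd G u
  ∈-nbhd {u} = ∈-tabulate⁺ (adj G u)

  three-neighbours⇒3≤deg : ∀ {u a b c} → u ~[ G ] a → u ~[ G ] b → u ~[ G ] c →
                           a ≢ b → a ≢ c → b ≢ c → 3 ≤ deg G u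
  three-neighbours⇒3≤deg u~a u~b u~c =
    three-members⇒3≤∣p∣ (∈-nbhd u~a) (∈-nbhd u~b) (∈-nbhd u~c)

  third-neighbour : ∀ {u a b} → u ~[ G ] a → u ~[ G ] b → a ≢ b → deg G u ≢ 2 →
                    ∃[ w ] (u ~[ G ] w × w ≢ a × w ≢ b)
  third-neighbour {u} {a} {b} u~a u~b a≢b deg≢2 with ∣ nbhd G u - a - b ∣ in size
  ... | zero = contradiction deg≡2 deg≢2
    where
    b∈N-a = x∈p∧x≢y⇒x∈p-y (∈-nbhd u~b) (≢-sym a≢b)
    deg≡2 : deg G u ≡ 2
    deg≡2 = begin
      deg G u                      ≡⟨ sym (x∈p⇒suc∣p-x∣≡∣p∣ (∈-nbhd u~a)) ⟩
      suc ∣ nbhd G u - a ∣         ≡⟨ cong suc (sym (x∈p⇒suc∣p-x∣≡∣p∣ b∈N-a)) ⟩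
      2 + ∣ nbhd G u - a - b ∣     ≡⟨ cong (2 +_) size ⟩
      2                            ∎
      where open ≡-Reasoning
  ... | suc _
    with w , w∈N-a-b ← 0<∣p∣⇒Nonempty {p = nbhd G u - a - b} (subst (0 <_) (sym size) (s≤s z≤n)) =
    w , ∈-tabulate⁻ (adj G u) (p─q⊆p _ _ (p─q⊆p _ _ w∈N-a-b)) ,
    x∈p-y⇒x≢y (p─q⊆p _ _ w∈N-a-b) , x∈p-y⇒x≢y w∈N-a-b

OnlyWhiteNeighbour : ∀ {n} → Graph n → Subset n → Fin n → Fin n → Set
OnlyWhiteNeighbour H B v w = ∀ w′ → v ~[ H ] w′ → w′ ∉ B → w′ ≡ w

record Square {n} (G : Graph n) : Set where
  constructor square
  field
    a b c d : Fin n
    a~b : a ~[ G ] b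
    b~c : b ~[ G ] c
    c~d : c ~[ G ] d
    d~a : d ~[ G ] a
    a≢c : a ≢ c
    b≢d : b ≢ d

NoSquareEdgeOfBranchVertices : ∀ {n} → Graph n → Set
NoSquareEdgeOfBranchVertices G =
  (s : Square G) → 3 ≤ deg G (Square.a s) → 3 ≤ deg G (Square.b s) → ⊥

module _ {n} (G : Graph n) (noBranchedSquareEdge : NoSquareEdgeOfBranchVertices G) where

  open GraphProperties G

  private
    H = complement G

    forcer-adj : ∀ {B v w x} → v ∈ B → OnlyWhiteNeighbour H B v w → x ∉ B → w ≢ x → v ~[ G ] x
    forcer-adj {v = v} {x = x} v∈B sole x∉B w≢x with adj G v x in v≁x
    ... | true = refl
    ... | false = contradiction (sym (sole x (complement-adj⁺ v≁x (λ { refl → x∉B v∈B })) x∉B)) w≢x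

    forcer-≢ : ∀ {v w u} → v ~[ H ] w → u ~[ G ] w → v ≢ u
    forcer-≢ v~̄w u~w refl = ~⇒¬complement-adj u~w v~̄w

    one-of-two-forced : ∀ {B v w x u u′} → v ∈ B → OnlyWhiteNeighbour H B v w → v ~[ H ] w →
                        x ∉ B → w ≢ x →
                        u ~[ G ] w → u ~[ G ] x → u′ ~[ G ] w → u′ ~[ G ] x → u ≢ u′ → 3 ≤ deg G u → ⊥
    one-of-two-forced {u = u} {u′} v∈B sole v~̄w x∉B w≢x u~w u~x u′~w u′~x u≢u′ 3≤deg-u =
      noBranchedSquareEdge (square u _ u′ _ u~x (~-sym u′~x) u′~w (~-sym u~w) u≢u′ (≢-sym w≢x)) 3≤deg-u
        (three-neighbours⇒3≤deg (~-sym u~x) (~-sym u′~x) (~-sym (forcer-adj v∈B sole x∉B w≢x))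
          u≢u′ (≢-sym (forcer-≢ v~̄w u~w)) (≢-sym (forcer-≢ v~̄w u′~w)))

  no-two-whites : ∀ {B a b u u′} → Forces H B → a ∉ B → b ∉ B → a ≢ b →
                  u ~[ G ] a → u ~[ G ] b → u′ ~[ G ] a → u′ ~[ G ] b → u ≢ u′ → 3 ≤ deg G u → ⊥
  no-two-whites (done all-blue) a∉B _ _ _ _ _ _ _ _ = a∉B (all-blue _)
  no-two-whites {a = a} {b} (force v w v∈B _ v~̄w sole rest) a∉B b∉B a≢b u~a u~b u′~a u′~b u≢u′ 3≤deg-u
    with w ≟ a | w ≟ b
  ... | yes refl | _ = one-of-two-forced v∈B sole v~̄w b∉B a≢b u~a u~b u′~a u′~b u≢u′ 3≤deg-u
  ... | no _ | yes refl = one-of-two-forced v∈B sole v~̄w a∉B (≢-sym a≢b) u~b u~a u′~b u′~a u≢u′ 3≤deg-u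
  ... | no w≢a | no w≢b =
    no-two-whites rest (x∉p∧y≢x⇒x∉p∪⁅y⁆ a∉B w≢a) (x∉p∧y≢x⇒x∉p∪⁅y⁆ b∉B w≢b)
      a≢b u~a u~b u′~a u′~b u≢u′ 3≤deg-u

  private
    one-of-three-forced : ∀ {B v w x y u} → Forces H (B ∪ ⁅ w ⁆) → v ∈ B → OnlyWhiteNeighbour H B v w →
                          v ~[ H ] w →
                          x ∉ B → y ∉ B → w ≢ x → w ≢ y → x ≢ y →
                          u ~[ G ] w → u ~[ G ] x → u ~[ G ] y → ⊥
    one-of-three-forced rest v∈B sole v~̄w x∉B y∉B w≢x w≢y x≢y u~w u~x u~y =
      no-two-whites rest (x∉p∧y≢x⇒x∉p∪⁅y⁆ x∉B w≢x) (x∉p∧y≢x⇒x∉p∪⁅y⁆ y∉B w≢y) x≢y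
        u~x u~y (forcer-adj v∈B sole x∉B w≢x) (forcer-adj v∈B sole y∉B w≢y)
        (≢-sym (forcer-≢ v~̄w u~w)) (three-neighbours⇒3≤deg u~w u~x u~y w≢x w≢y x≢y)

  no-three-whites : ∀ {B a b c u} → Forces H B → a ∉ B → b ∉ B → c ∉ B → a ≢ b → a ≢ c → b ≢ c →
                    u ~[ G ] a → u ~[ G ] b → u ~[ G ] c → ⊥
  no-three-whites (done all-blue) a∉B _ _ _ _ _ _ _ _ = a∉B (all-blue _)
  no-three-whites {a = a} {b} {c} (force v w v∈B _ v~̄w sole rest) a∉B b∉B c∉B a≢b a≢c b≢c u~a u~b u~c
    with w ≟ a | w ≟ b | w ≟ c
  ... | yes refl | _ | _ =
    one-of-three-forced rest v∈B sole v~̄w b∉B c∉B a≢b a≢c b≢c u~a u~b u~c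
  ... | no _ | yes refl | _ =
    one-of-three-forced rest v∈B sole v~̄w a∉B c∉B (≢-sym a≢b) b≢c a≢c u~b u~a u~c
  ... | no _ | no _ | yes refl =
    one-of-three-forced rest v∈B sole v~̄w a∉B b∉B (≢-sym a≢c) (≢-sym b≢c) a≢b u~c u~a u~b
  ... | no w≢a | no w≢b | no w≢c =
    no-three-whites rest (x∉p∧y≢x⇒x∉p∪⁅y⁆ a∉B w≢a) (x∉p∧y≢x⇒x∉p∪⁅y⁆ b∉B w≢b)
      (x∉p∧y≢x⇒x∉p∪⁅y⁆ c∉B w≢c) a≢b a≢c b≢c u~a u~b u~c

  private
    one-of-four-forced : ∀ {B v w x y z} → Forces H (B ∪ ⁅ w ⁆) → v ∈ B → OnlyWhiteNeighbour H B v w →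
                         x ∉ B → y ∉ B → z ∉ B → w ≢ x → w ≢ y → w ≢ z → x ≢ y → x ≢ z → y ≢ z → ⊥
    one-of-four-forced rest v∈B sole x∉B y∉B z∉B w≢x w≢y w≢z x≢y x≢z y≢z =
      no-three-whites rest (x∉p∧y≢x⇒x∉p∪⁅y⁆ x∉B w≢x) (x∉p∧y≢x⇒x∉p∪⁅y⁆ y∉B w≢y)
        (x∉p∧y≢x⇒x∉p∪⁅y⁆ z∉B w≢z) x≢y x≢z y≢z
        (forcer-adj v∈B sole x∉B w≢x) (forcer-adj v∈B sole y∉B w≢y)
        (forcer-adj v∈B sole z∉B w≢z)

  no-four-whites : ∀ {B a b c d} → Forces H B → a ∉ B → b ∉ B → c ∉ B → d ∉ B →
                   a ≢ b → a ≢ c → a ≢ d → b ≢ c → b ≢ d → c ≢ d → ⊥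
  no-four-whites (done all-blue) a∉B _ _ _ _ _ _ _ _ _ = a∉B (all-blue _)
  no-four-whites {a = a} {b} {c} {d} (force v w v∈B _ _ sole rest) a∉B b∉B c∉B d∉B
                 a≢b a≢c a≢d b≢c b≢d c≢d
    with w ≟ a | w ≟ b | w ≟ c | w ≟ d
  ... | yes refl | _ | _ | _ =
    one-of-four-forced rest v∈B sole b∉B c∉B d∉B a≢b a≢c a≢d b≢c b≢d c≢d
  ... | no _ | yes refl | _ | _ =
    one-of-four-forced rest v∈B sole a∉B c∉B d∉B (≢-sym a≢b) b≢c b≢d a≢c a≢d c≢d
  ... | no _ | no _ | yes refl | _ =
    one-of-four-forced rest v∈B sole a∉B b∉B d∉B (≢-sym a≢c) (≢-sym b≢c) c≢d a≢b a≢d b≢d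
  ... | no _ | no _ | no _ | yes refl =
    one-of-four-forced rest v∈B sole a∉B b∉B c∉B (≢-sym a≢d) (≢-sym b≢d) (≢-sym c≢d) a≢b a≢c b≢c
  ... | no w≢a | no w≢b | no w≢c | no w≢d =
    no-four-whites rest (x∉p∧y≢x⇒x∉p∪⁅y⁆ a∉B w≢a) (x∉p∧y≢x⇒x∉p∪⁅y⁆ b∉B w≢b)
      (x∉p∧y≢x⇒x∉p∪⁅y⁆ c∉B w≢c) (x∉p∧y≢x⇒x∉p∪⁅y⁆ d∉B w≢d) a≢b a≢c a≢d b≢c b≢d c≢d

  zero-forcing-lower-bound : ∀ B → IsZeroForcingSet H B → n ∸ 3 ≤ ∣ B ∣
  zero-forcing-lower-bound B forcing with ∣ ∁ B ∣ ≤? 3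
  ... | yes ∣∁B∣≤3 = m∸n≤o⇒m∸o≤n n ∣ B ∣ 3 (subst (_≤ 3) (∣∁p∣≡n∸∣p∣ B) ∣∁B∣≤3)
  ... | no ∣∁B∣≰3
    with a , a∈ , 3≤ ← remove-member {p = ∁ B} (≰⇒> ∣∁B∣≰3)
    with b , b∈ , 2≤ ← remove-member {p = ∁ B - a} 3≤
    with c , c∈ , 1≤ ← remove-member {p = ∁ B - a - b} 2≤
    with d , d∈ , _  ← remove-member {p = ∁ B - a - b - c} 1≤ =
    ⊥-elim (no-four-whites forcing (white a∈) (white (drop b∈)) (white (drop (drop c∈)))
      (white (drop (drop (drop d∈))))
      (≢-sym (x∈p-y⇒x≢y b∈)) (≢-sym (x∈p-y⇒x≢y (drop c∈))) (≢-sym (x∈p-y⇒x≢y (drop (drop d∈))))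
      (≢-sym (x∈p-y⇒x≢y c∈)) (≢-sym (x∈p-y⇒x≢y (drop d∈))) (≢-sym (x∈p-y⇒x≢y d∈)))
    where
    white : ∀ {v} → v ∈ ∁ B → v ∉ B
    white = x∈∁p⇒x∉p
    drop : ∀ {p : Subset n} {v x} → v ∈ p - x → v ∈ p
    drop = p─q⊆p _ _

module _ {n} (G : Graph n) where

  open GraphProperties G

  complement-forcing-set : ∀ {x y z u u′} → x ≢ y → x ≢ z → y ≢ z → adj G y z ≡ false →
                           u ≢ x → adj G u x ≡ false → u ~[ G ] y → u ~[ G ] z →
                           u′ ≢ y → adj G u′ y ≡ false → u′ ~[ G ] z →
                           IsZeroForcingSet (complement G) (⊤ - x - y - z)
  complement-forcing-set {x} {y} {z} {u} {u′} x≢y x≢z y≢z y≁z u≢x u≁x u~y u~z u′≢y u′≁y u′~z =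
    force u x (∈⊤-x-y-z u≢x (~⇒≢ u~y) (~⇒≢ u~z)) x∉B (complement-adj⁺ u≁x u≢x) u-sole
      (force u′ y u′-blue (still y∉B x≢y) (complement-adj⁺ u′≁y u′≢y) u′-sole
        (force y z (new y) (still (still z∉B x≢z) y≢z) (complement-adj⁺ y≁z y≢z) y-sole
          (done all-blue)))
    where
    B = ⊤ - x - y - z
    still = x∉p∧y≢x⇒x∉p∪⁅y⁆
    old : ∀ {p : Subset n} {w v} → v ∈ p → v ∈ p ∪ ⁅ w ⁆
    old v∈p = x∈p∪q⁺ (inj₁ v∈p)
    new : ∀ {p : Subset n} w → w ∈ p ∪ ⁅ w ⁆
    new w = x∈p∪q⁺ (inj₂ (x∈⁅x⁆ w))
    x∉B : x ∉ B
    x∉B x∈B = x∈p-y⇒x≢y (p─q⊆p _ _ (p─q⊆p _ _ x∈B)) refl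
    y∉B : y ∉ B
    y∉B y∈B = x∈p-y⇒x≢y (p─q⊆p _ _ y∈B) refl
    z∉B : z ∉ B
    z∉B z∈B = x∈p-y⇒x≢y z∈B refl
    u-sole : OnlyWhiteNeighbour (complement G) B u x
    u-sole w u~̄w w∉B with ∉⊤-x-y-z w∉B
    ... | inj₁ w≡x = w≡x
    ... | inj₂ (inj₁ refl) = contradiction u~̄w (~⇒¬complement-adj u~y)
    ... | inj₂ (inj₂ refl) = contradiction u~̄w (~⇒¬complement-adj u~z)
    u′-blue : u′ ∈ B ∪ ⁅ x ⁆
    u′-blue with u′ ≟ x
    ... | yes refl = new x
    ... | no u′≢x = old (∈⊤-x-y-z u′≢x u′≢y (~⇒≢ u′~z))
    u′-sole : OnlyWhiteNeighbour (complement G) (B ∪ ⁅ x ⁆) u′ y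
    u′-sole w u′~̄w w∉ with ∉⊤-x-y-z (x∉p∪q⇒x∉p w∉)
    ... | inj₁ w≡x = contradiction w≡x (x∉p∪⁅y⁆⇒x≢y w∉)
    ... | inj₂ (inj₁ w≡y) = w≡y
    ... | inj₂ (inj₂ refl) = contradiction u′~̄w (~⇒¬complement-adj u′~z)
    y-sole : OnlyWhiteNeighbour (complement G) ((B ∪ ⁅ x ⁆) ∪ ⁅ y ⁆) y z
    y-sole w _ w∉ with ∉⊤-x-y-z (x∉p∪q⇒x∉p (x∉p∪q⇒x∉p w∉))
    ... | inj₁ w≡x = contradiction w≡x (x∉p∪⁅y⁆⇒x≢y (x∉p∪q⇒x∉p w∉))
    ... | inj₂ (inj₁ w≡y) = contradiction w≡y (x∉p∪⁅y⁆⇒x≢y w∉)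
    ... | inj₂ (inj₂ w≡z) = w≡z
    all-blue : ∀ v → v ∈ ((B ∪ ⁅ x ⁆) ∪ ⁅ y ⁆) ∪ ⁅ z ⁆
    all-blue v with v ∈? B
    ... | yes v∈B = old (old (old v∈B))
    ... | no v∉B with ∉⊤-x-y-z v∉B
    ... | inj₁ refl = old (old (new x))
    ... | inj₂ (inj₁ refl) = old (new y)
    ... | inj₂ (inj₂ refl) = new z

  forcing-set-of-size-n∸3 : ∀ {x y z u u′} → x ≢ y → x ≢ z → y ≢ z → adj G y z ≡ false →
                    u ≢ x → adj G u x ≡ false → u ~[ G ] y → u ~[ G ] z →
                    u′ ≢ y → adj G u′ y ≡ false → u′ ~[ G ] z →
                    ∃[ B ] (IsZeroForcingSet (complement G) B × ∣ B ∣ ≡ n ∸ 3)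
  forcing-set-of-size-n∸3 x≢y x≢z y≢z y≁z u≢x u≁x u~y u~z u′≢y u′≁y u′~z =
    _ , complement-forcing-set x≢y x≢z y≢z y≁z u≢x u≁x u~y u~z u′≢y u′≁y u′~z , ∣⊤-x-y-z∣≡n∸3 x≢y x≢z y≢z

open Equivalence using (to; from)

module _ {n} (G : Graph n) where

  open GraphProperties G

  Square⇒Cycle : Square G → Cycle G
  Square⇒Cycle (square a b c d a~b b~c c~d d~a a≢c b≢d) = record
    { m = 3 ; len≥3 = s≤s (s≤s (s≤s z≤n)) ; vtx = corner ; inj = corner-inj ; edges = corner-edges }
    where
    corner : Fin 4 → Fin n
    corner zero = a
    corner (suc zero) = b
    corner (suc (suc zero)) = c
    corner (suc (suc (suc zero))) = d
    a≢b = ~⇒≢ a~b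
    a≢d = ≢-sym (~⇒≢ d~a)
    b≢c = ~⇒≢ b~c
    c≢d = ~⇒≢ c~d
    corner-inj : ∀ {i j} → corner i ≡ corner j → i ≡ j
    corner-inj {zero} {zero} _ = refl
    corner-inj {zero} {suc zero} e = contradiction e a≢b
    corner-inj {zero} {suc (suc zero)} e = contradiction e a≢c
    corner-inj {zero} {suc (suc (suc zero))} e = contradiction e a≢d
    corner-inj {suc zero} {zero} e = contradiction (sym e) a≢b
    corner-inj {suc zero} {suc zero} _ = refl
    corner-inj {suc zero} {suc (suc zero)} e = contradiction e b≢c
    corner-inj {suc zero} {suc (suc (suc zero))} e = contradiction e b≢d
    corner-inj {suc (suc zero)} {zero} e = contradiction (sym e) a≢c
    corner-inj {suc (suc zero)} {suc zero} e = contradiction (sym e) b≢c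
    corner-inj {suc (suc zero)} {suc (suc zero)} _ = refl
    corner-inj {suc (suc zero)} {suc (suc (suc zero))} e = contradiction e c≢d
    corner-inj {suc (suc (suc zero))} {zero} e = contradiction (sym e) a≢d
    corner-inj {suc (suc (suc zero))} {suc zero} e = contradiction (sym e) b≢d
    corner-inj {suc (suc (suc zero))} {suc (suc zero)} e = contradiction (sym e) c≢d
    corner-inj {suc (suc (suc zero))} {suc (suc (suc zero))} _ = refl
    corner-edges : ∀ i → corner i ~[ G ] corner (next i)
    corner-edges zero = a~b
    corner-edges (suc zero) = b~c
    corner-edges (suc (suc zero)) = c~d
    corner-edges (suc (suc (suc zero))) = d~a

  unicyclic-shared-vertex : Unicyclic G → (C D : Cycle G) → ∀ i → ∃[ j ] Cycle.vtx D j ≡ Cycle.vtx C i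
  unicyclic-shared-vertex (_ , _ , unique) C D i
    with to (unique D _ _) (from (unique C _ _) (i , inj₁ (refl , refl)))
  ... | j , inj₁ (vtx-j≡ , _) = j , vtx-j≡
  ... | j , inj₂ (_ , vtx-next-j≡) = next j , vtx-next-j≡

  long-unique-cycle⇒no-square : Unicyclic G → (C : Cycle G) → 5 ≤ suc (Cycle.m C) → Square G → ⊥
  long-unique-cycle⇒no-square U C 5≤ℓ s = <-irrefl refl (≤-trans 5≤ℓ (injective⇒≤ position-inj))
    where
    D = Square⇒Cycle s
    shared = unicyclic-shared-vertex U C D
    position-inj : ∀ {i j} → proj₁ (shared i) ≡ proj₁ (shared j) → i ≡ j
    position-inj {i} {j} same-corner = Cycle.inj C (begin
      Cycle.vtx C i                     ≡⟨ proj₂ (shared i) ⟨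
      Cycle.vtx D (proj₁ (shared i))    ≡⟨ cong (Cycle.vtx D) same-corner ⟩
      Cycle.vtx D (proj₁ (shared j))    ≡⟨ proj₂ (shared j) ⟩
      Cycle.vtx C j                     ∎)
      where open ≡-Reasoning

module InducedCycleProperties {n m} (G : Graph n) {c : Fin (suc m) → Fin n} (ind : InducedCycle G m c)
  where

  induced-≢ : ∀ {i j} → i ≢ j → c i ≢ c j
  induced-≢ i≢j ci≡cj = i≢j (proj₁ ind ci≡cj)

  induced-adj : ∀ {i j} → j ≡ next i ⊎ i ≡ next j → c i ~[ G ] c j
  induced-adj {i} {j} = from (proj₂ ind i j)

  induced-consecutive : ∀ {i j} → c i ~[ G ] c j → j ≡ next i ⊎ i ≡ next j
  induced-consecutive {i} {j} = to (proj₂ ind i j)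

  induced-nonadj : ∀ {i j} → j ≢ next i → i ≢ next j → adj G (c i) (c j) ≡ false
  induced-nonadj {i} {j} j≢next-i i≢next-j with adj G (c i) (c j) in ci~cj
  ... | false = refl
  ... | true with induced-consecutive ci~cj
  ... | inj₁ j≡next-i = contradiction j≡next-i j≢next-i
  ... | inj₂ i≡next-j = contradiction i≡next-j i≢next-j

InducedCycle⇒Cycle : ∀ {n m} (G : Graph n) {c : Fin (suc m) → Fin n} →
                     3 ≤ suc m → InducedCycle G m c → Cycle G
InducedCycle⇒Cycle {m = m} G {c} 3≤ℓ ind = record
  { m = m ; len≥3 = 3≤ℓ ; vtx = c ; inj = proj₁ ind ; edges = λ i → induced-adj (inj₁ refl) }
  where open InducedCycleProperties G ind

long-induced-cycle-forcing-set : ∀ {n k} (G : Graph n) {c : Fin (5 + k) → Fin n} →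
                                 InducedCycle G (4 + k) c →
                                 ∃[ B ] (IsZeroForcingSet (complement G) B × ∣ B ∣ ≡ n ∸ 3)
long-induced-cycle-forcing-set G {c = c} ind =
  forcing-set-of-size-n∸3 G {x = c (# 3)} {y = c (# 0)} {z = c (# 2)} {u = c (# 1)} {u′ = c (# 3)}
    (induced-≢ λ ()) (induced-≢ λ ()) (induced-≢ λ ()) (induced-nonadj (λ ()) (λ ()))
    (induced-≢ λ ()) (induced-nonadj (λ ()) (λ ())) (induced-adj (inj₂ refl)) (induced-adj (inj₁ refl))
    (induced-≢ λ ()) (induced-nonadj (λ ()) (λ ())) (induced-adj (inj₂ refl))
  where open InducedCycleProperties G ind

next⁴≡id : (i : Fin 4) → next (next (next (next i))) ≡ i
next⁴≡id zero = refl
next⁴≡id (suc zero) = refl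
next⁴≡id (suc (suc zero)) = refl
next⁴≡id (suc (suc (suc zero))) = refl

next-injective : ∀ {i j : Fin 4} → next i ≡ next j → i ≡ j
next-injective {i} {j} next-i≡next-j = begin
  i                              ≡⟨ next⁴≡id i ⟨
  next (next (next (next i)))    ≡⟨ cong (λ k → next (next (next k))) next-i≡next-j ⟩
  next (next (next (next j)))    ≡⟨ next⁴≡id j ⟩
  j                              ∎
  where open ≡-Reasoning

next≢id : (i : Fin 4) → next i ≢ i
next≢id zero = λ ()
next≢id (suc zero) = λ ()
next≢id (suc (suc zero)) = λ ()
next≢id (suc (suc (suc zero))) = λ ()

next²≢id : (i : Fin 4) → next (next i) ≢ i
next²≢id zero = λ ()
next²≢id (suc zero) = λ ()
next²≢id (suc (suc zero)) = λ ()
next²≢id (suc (suc (suc zero))) = λ ()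

next³≢id : (i : Fin 4) → next (next (next i)) ≢ i
next³≢id i next³-i≡i = next≢id i (sym (trans (sym (next⁴≡id i)) (cong next next³-i≡i)))

rotate-induced-square : ∀ {n} (G : Graph n) {c : Fin 4 → Fin n} →
                        InducedCycle G 3 c → InducedCycle G 3 (c ∘ next)
rotate-induced-square G (c-inj , c-adj) =
  next-injective ∘ c-inj ,
  λ i j → mk⇔ (Sum.map next-injective next-injective ∘ to (c-adj (next i) (next j)))
              (from (c-adj (next i) (next j)) ∘ Sum.map (cong next) (cong next))

module UnicyclicSquare {n} (G : Graph n) (U : Unicyclic G) where

  open GraphProperties G

  module _ {c : Fin 4 → Fin n} (ind : InducedCycle G 3 c) where

    open InducedCycleProperties G ind

    private
      C = InducedCycle⇒Cycle G (s≤s (s≤s (s≤s z≤n))) ind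
      c₁~c₀ = induced-adj {# 1} {# 0} (inj₂ refl)
      c₁~c₂ = induced-adj {# 1} {# 2} (inj₁ refl)

      branch : ∀ {k v} → c k ≡ v → 3 ≤ deg G v → deg G (c k) ≢ 2
      branch refl 3≤deg = ≢-sym (<⇒≢ 3≤deg)

    branch-at-one-forcing-set : deg G (c (# 1)) ≢ 2 →
                                ∃[ B ] (IsZeroForcingSet (complement G) B × ∣ B ∣ ≡ n ∸ 3)
    branch-at-one-forcing-set deg≢2
      with p , c₁~p , p≢c₀ , p≢c₂ ← third-neighbour c₁~c₀ c₁~c₂ (induced-≢ λ ()) deg≢2 =
      forcing-set-of-size-n∸3 G {x = c (# 2)} {y = c (# 3)} {z = c (# 1)} {u = c (# 0)} {u′ = p}
        (induced-≢ λ ()) (induced-≢ λ ()) (induced-≢ λ ()) (induced-nonadj (λ ()) (λ ()))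
        (induced-≢ λ ()) (induced-nonadj (λ ()) (λ ())) (induced-adj (inj₂ refl)) (induced-adj (inj₁ refl))
        (≢-sym (off-cycle (# 3))) p≁c₃ (~-sym c₁~p)
      where
      off-cycle : ∀ k → c k ≢ p
      off-cycle zero = ≢-sym p≢c₀
      off-cycle (suc zero) = ~⇒≢ c₁~p
      off-cycle (suc (suc zero)) = ≢-sym p≢c₂
      off-cycle (suc (suc (suc zero))) refl = ≁⇒¬~ (induced-nonadj (λ ()) (λ ())) c₁~p
      p≁c₃ : adj G p (c (# 3)) ≡ false
      p≁c₃ with adj G p (c (# 3)) in p~c₃
      ... | false = refl
      ... | true
        with k , cₖ≡p ← unicyclic-shared-vertex G U
               (Square⇒Cycle G (square p _ _ _ (~-sym c₁~p) c₁~c₂ (induced-adj (inj₁ refl)) (~-sym p~c₃)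
                                       p≢c₂ (induced-≢ λ ())))
               C zero
        = contradiction cₖ≡p (off-cycle k)

    no-branched-square-edge : (∀ i → deg G (c i) ≢ 2 → deg G (c (next i)) ≢ 2 → ⊥) →
                              NoSquareEdgeOfBranchVertices G
    no-branched-square-edge no-adjacent-branches s 3≤deg-a 3≤deg-b
      with i , cᵢ≡a ← unicyclic-shared-vertex G U (Square⇒Cycle G s) C zero
         | j , cⱼ≡b ← unicyclic-shared-vertex G U (Square⇒Cycle G s) C (suc zero)
      with induced-consecutive {i} {j} (subst₂ (λ x y → x ~[ G ] y) (sym cᵢ≡a) (sym cⱼ≡b) (Square.a~b s))
    ... | inj₁ refl = no-adjacent-branches i (branch cᵢ≡a 3≤deg-a) (branch cⱼ≡b 3≤deg-b)
    ... | inj₂ refl = no-adjacent-branches j (branch cⱼ≡b 3≤deg-b) (branch cᵢ≡a 3≤deg-a)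

  private
    rotate = rotate-induced-square G

  square-forcing-set : ∀ {c : Fin 4 → Fin n} → InducedCycle G 3 c → ∀ i → deg G (c i) ≢ 2 →
                       ∃[ B ] (IsZeroForcingSet (complement G) B × ∣ B ∣ ≡ n ∸ 3)
  square-forcing-set ind (suc zero) = branch-at-one-forcing-set ind
  square-forcing-set ind (suc (suc zero)) = branch-at-one-forcing-set (rotate ind)
  square-forcing-set ind (suc (suc (suc zero))) =
    branch-at-one-forcing-set (rotate (rotate ind))
  square-forcing-set ind zero =
    branch-at-one-forcing-set (rotate (rotate (rotate ind)))

module DegreeTwoCount {n} (G : Graph n) (c : Fin 4 → Fin n) where

  open GraphProperties G

  private
    is-deg-2 : Fin 4 → Bool
    is-deg-2 i = deg G (c i) ≡ᵇ 2

    Branches : Subset 4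
    Branches = ∁ (tabulate is-deg-2)

    ∣Branches∣≡4∸ : ∀ {k} → deg2Count G c ≡ k → ∣ Branches ∣ ≡ 4 ∸ k
    ∣Branches∣≡4∸ count≡k = trans (∣∁p∣≡n∸∣p∣ (tabulate is-deg-2)) (cong (4 ∸_) count≡k)

    ∈Branches⁺ : ∀ {i} → deg G (c i) ≢ 2 → i ∈ Branches
    ∈Branches⁺ deg≢2 = x∉p⇒x∈∁p λ i∈S → deg≢2 (≡ᵇ⇒≡ _ 2 (from T-≡ (∈-tabulate⁻ is-deg-2 i∈S)))

    ∈Branches⁻ : ∀ {i} → i ∈ Branches → deg G (c i) ≢ 2
    ∈Branches⁻ i∈Branches deg≡2 = x∈∁p⇒x∉p i∈Branches (∈-tabulate⁺ is-deg-2 (to T-≡ (≡⇒≡ᵇ _ 2 deg≡2)))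

    at-most-one-branch : deg2Count G c ≡ 3 → ∀ {i j} → deg G (c i) ≢ 2 → deg G (c j) ≢ 2 → i ≢ j → ⊥
    at-most-one-branch count≡3 branch-i branch-j i≢j =
      <-irrefl refl (subst (2 ≤_) (∣Branches∣≡4∸ count≡3)
        (two-members⇒2≤∣p∣ (∈Branches⁺ branch-i) (∈Branches⁺ branch-j) i≢j))

    at-most-two-branches : deg2Count G c ≡ 2 → ∀ {i j k} → deg G (c i) ≢ 2 → deg G (c j) ≢ 2 →
                           deg G (c k) ≢ 2 → i ≢ j → i ≢ k → j ≢ k → ⊥
    at-most-two-branches count≡2 branch-i branch-j branch-k i≢j i≢k j≢k =
      <-irrefl refl (subst (3 ≤_) (∣Branches∣≡4∸ count≡2)
        (three-members⇒3≤∣p∣ (∈Branches⁺ branch-i) (∈Branches⁺ branch-j) (∈Branches⁺ branch-k)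
          i≢j i≢k j≢k))

  branch-index : deg2Count G c < 4 → ∃[ i ] deg G (c i) ≢ 2
  branch-index count<4
    with i , i∈Branches ← 0<∣p∣⇒Nonempty (subst (0 <_) (sym (∣Branches∣≡4∸ refl)) (m<n⇒0<n∸m count<4))
    = i , ∈Branches⁻ i∈Branches

  single-branch⇒no-adjacent-branches : deg2Count G c ≡ 3 →
                                       ∀ i → deg G (c i) ≢ 2 → deg G (c (next i)) ≢ 2 → ⊥
  single-branch⇒no-adjacent-branches count≡3 i branch-i branch-next-i =
    at-most-one-branch count≡3 branch-i branch-next-i (≢-sym (next≢id i))

  opposite-branches⇒no-adjacent-branches :
    InducedCycle G 3 c → deg2Count G c ≡ 2 →
    (∀ i j → deg G (c i) ≡ 2 → deg G (c j) ≡ 2 → adj G (c i) (c j) ≡ false) →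
    ∀ i → deg G (c i) ≢ 2 → deg G (c (next i)) ≢ 2 → ⊥
  opposite-branches⇒no-adjacent-branches ind count≡2 deg₂-apart i branch-i branch-next-i
    with deg G (c (next (next i))) ℕ.≟ 2 | deg G (c (next (next (next i)))) ℕ.≟ 2
  ... | no branch-i+2 | _ =
    at-most-two-branches count≡2 branch-i branch-next-i branch-i+2
      (≢-sym (next≢id i)) (≢-sym (next²≢id i)) (≢-sym (next≢id (next i)))
  ... | yes _ | no branch-i+3 =
    at-most-two-branches count≡2 branch-i branch-next-i branch-i+3
      (≢-sym (next≢id i)) (≢-sym (next³≢id i)) (≢-sym (next²≢id (next i)))
  ... | yes deg₂-i+2 | yes deg₂-i+3 =
    ≁⇒¬~ (deg₂-apart _ _ deg₂-i+2 deg₂-i+3) (InducedCycleProperties.induced-adj G ind (inj₁ refl))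

long-induced-cycle-zero-forcing-number : ∀ {n k} (G : Graph n) {c : Fin (5 + k) → Fin n} →
                                         Unicyclic G → InducedCycle G (4 + k) c →
                                         ZeroForcingNumber (complement G) (n ∸ 3)
long-induced-cycle-zero-forcing-number G U ind =
  long-induced-cycle-forcing-set G ind ,
  zero-forcing-lower-bound G λ s _ _ →
    long-unique-cycle⇒no-square G U (InducedCycle⇒Cycle G (s≤s (s≤s (s≤s z≤n))) ind)
      (s≤s (s≤s (s≤s (s≤s (s≤s z≤n))))) s

induced-square-zero-forcing-number : ∀ {n} (G : Graph n) {c : Fin 4 → Fin n} →
                                     Unicyclic G → InducedCycle G 3 c → deg2Count G c < 4 →
                                     (∀ i → deg G (c i) ≢ 2 → deg G (c (next i)) ≢ 2 → ⊥) →
                                     ZeroForcingNumber (complement G) (n ∸ 3)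
induced-square-zero-forcing-number G {c} U ind count<4 no-adjacent-branches
  with i , branch-i ← DegreeTwoCount.branch-index G c count<4 =
  square-forcing-set ind i branch-i ,
  zero-forcing-lower-bound G (no-branched-square-edge ind no-adjacent-branches)
  where open UnicyclicSquare G U

corollary3p10 : (n : ℕ) (G : Graph n) →
    Unicyclic G →
    ¬ IsStarPlusEdge G →
    ((∃[ m ] (5 ≤ suc m × ∃[ c ] InducedCycle G m c))
     ⊎ (∃[ c ] (InducedCycle G 3 c × deg2Count G c ≡ 2 ×
          (∀ i j → deg G (c i) ≡ 2 → deg G (c j) ≡ 2 → adj G (c i) (c j) ≡ false)))
     ⊎ (∃[ c ] (InducedCycle G 3 c × deg2Count G c ≡ 3))) →
    ZeroForcingNumber (complement G) (n ∸ 3)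
-- Excluding K_{1,n-1}+e is redundant: the cycle of that graph is a triangle.
corollary3p10 n G U _ (inj₁ (_ , s≤s (s≤s (s≤s (s≤s (s≤s _)))) , c , ind)) =
  long-induced-cycle-zero-forcing-number G U ind
corollary3p10 n G U _ (inj₂ (inj₁ (c , ind , count≡2 , deg₂-apart))) =
  induced-square-zero-forcing-number G U ind (m≤n⇒m≤1+n (≤-reflexive (cong suc count≡2)))
    (DegreeTwoCount.opposite-branches⇒no-adjacent-branches G c ind count≡2 deg₂-apart)
corollary3p10 n G U _ (inj₂ (inj₂ (c , ind , count≡3))) =
  induced-square-zero-forcing-number G U ind (≤-reflexive (cong suc count≡3))
    (DegreeTwoCount.single-branch⇒no-adjacent-branches G c count≡3)
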